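{- Let $u\in\{0,1\}^*$ and let $\underline{u}$ be the word obtained from $u$ by replacing every $0$ by $1$ and every $1$ by $0$. Then $$\#\left\{v\in L_2 : \binom{1u}{v}>0\right\}=\#\left\{v\in L_2 : \binom{1\underline{u}}{v}>0\right\}.$$ In particular, for all integers $\ell\ge 1$ and $2^{\ell-1}\le r<2^\ell$, $S(2^\ell+r)=S(2^{\ell+1}-r-1)$.
   Context: For finite words $u,v$ over $\{0,1\}$, $\binom{u}{v}$ is the number of occurrences of $v$ as a (scattered) subword (subsequence) of $u$. $L_2=\{\varepsilon\}\cup 1\{0,1\}^*$. For $n\ge 1$, $\mathrm{rep}_2(n)$ is the base-$2$ expansion of $n$ with most significant digit first, $\mathrm{rep}_2(0)=\varepsilon$, and $S(n)=\#\{v\in L_2 : \binom{\mathrm{rep}_2(n)}{v}>0\}$. -}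

module Defs where

open import Data.Bool using (Bool; true; false; not; if_then_else_)
open import Data.Bool.Properties using () renaming (_≟_ to _≟ᵇ_)
open import Data.List using (List; []; _∷_; length; map; filter; _++_; reverse; concatMap)
open import Data.Nat using (ℕ; zero; suc; _+_; _<_; _≡ᵇ_; _/_; _%_; _<?_)
open import Data.Product using (_×_)
open import Relation.Nullary using (Dec; yes; no)
open import Relation.Nullary.Decidable using (_×-dec_)
open import Relation.Binary.PropositionalEquality using (_≡_)

-- Words over {0,1}: false = 0, true = 1.
Word : Set
Word = List Bool

binom : Word → Word → ℕ
binom u [] = 1
binom [] (_ ∷ _) = 0
binom (a ∷ u) (b ∷ v) with a ≟ᵇ b
... | yes _ = binom u (b ∷ v) + binom u v
... | no _  = binom u (b ∷ v)

InL2 : Word → Set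
InL2 [] = ⊤'
  where open import Data.Unit using () renaming (⊤ to ⊤')
InL2 (b ∷ _) = b ≡ true

inL2? : (v : Word) → Dec (InL2 v)
inL2? [] = yes _
inL2? (b ∷ _) = b ≟ᵇ true

wordsOfLength : ℕ → List Word
wordsOfLength zero = [] ∷ []
wordsOfLength (suc n) = concatMap (λ w → (false ∷ w) ∷ (true ∷ w) ∷ []) (wordsOfLength n)

wordsUpTo : ℕ → List Word
wordsUpTo zero = wordsOfLength zero
wordsUpTo (suc n) = wordsUpTo n ++ wordsOfLength (suc n)

-- #{ v ∈ L_2 : binom u v > 0 }.  Since binom u v = 0 whenever |v| > |u|,
-- it suffices to enumerate the (distinct) words of length ≤ |u|.
countL2Subwords : Word → ℕ
countL2Subwords u = length (filter (λ v → inL2? v ×-dec (0 <? binom u v)) (wordsUpTo (length u)))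

complement : Word → Word
complement = map not

-- base-2 digits, least significant first (fuel-bounded; fuel n suffices for n)
lsbDigits : ℕ → ℕ → Word
lsbDigits zero _ = []
lsbDigits (suc f) zero = []
lsbDigits (suc f) (suc m) = ((suc m % 2) ≡ᵇ 1) ∷ lsbDigits f (suc m / 2)

rep2 : ℕ → Word
rep2 n = reverse (lsbDigits n n)

S : ℕ → ℕ
S n = countL2Subwords (rep2 n)

-- For v = 1v′ the word 1u contains v iff u contains v′ (an occurrence of 1v′
-- in 1u either uses the leading 1 or already lies in u, and in the latter case
-- u contains v′ as well).  So v ↦ head v ∷ complement (tail v), a bijection of
-- each set of words of fixed length, maps the L₂-subwords of 1u onto those of
-- 1ū.  For the numeric form, write r < 2^ℓ with ℓ bits w (least significant
-- first): then rep₂(2^ℓ + r) = 1 · reverse w, and complement w is the ℓ-bit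
-- expansion of 2^ℓ − 1 − r.
module Submission where

open import Defs
open import Data.Bool using (Bool; true; false; not; if_then_else_)
open import Data.Bool.Properties using () renaming (_≟_ to _≟ᵇ_)
open import Data.List using (List; []; _∷_; [_]; length; map; filter; _++_; reverse; concatMap)
open import Data.List.Properties using (length-map; map-++; map-cong; reverse-++; reverse-map)
open import Data.Nat.ListAction using (sum)
open import Data.Nat.ListAction.Properties using (sum-++)
open import Data.Nat using (ℕ; zero; suc; _+_; _*_; _∸_; _^_; _≤_; _<_; _<?_; _%_; _/_; _≡ᵇ_; s≤s; s≤s⁻¹; z≤n)
open import Data.Nat.Properties
open import Data.Nat.Tactic.RingSolver using (solve-∀)
open import Data.Nat.DivMod using (m*n/n≡m; m*n%n≡0; [m+kn]%n≡m%n; +-distrib-/; m<n⇒m%n≡m; m<n⇒m/n≡0)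
open import Algebra.Properties.CommutativeSemigroup +-commutativeSemigroup using (interchange)
open import Data.Product using (_×_; _,_; ∃)
open import Function using (_∘_; id; _⇔_; mk⇔; Equivalence)
open import Function.Construct.Composition using (_⇔-∘_)
open import Function.Construct.Symmetry using (⇔-sym)
open import Relation.Nullary using (Dec; does; yes; no; contradiction)
open import Relation.Nullary.Decidable using (_×-dec_; does-⇔)
open import Relation.Unary using (Pred; Decidable)
open import Relation.Binary.PropositionalEquality using (_≡_; refl; sym; trans; cong; cong₂; subst; module ≡-Reasoning)
open ≡-Reasoning

indicator : ∀ {p} {A : Set p} → Dec A → ℕ
indicator a? = if does a? then 1 else 0

length-filter-sum : ∀ {a p} {A : Set a} {P : Pred A p} (P? : Decidable P) (xs : List A) →
                    length (filter P? xs) ≡ sum (map (indicator ∘ P?) xs)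
length-filter-sum P? [] = refl
length-filter-sum P? (x ∷ xs) with does (P? x)
... | true  = cong suc (length-filter-sum P? xs)
... | false = length-filter-sum P? xs

sum-wordsOfLength-suc : ∀ n (f : Word → ℕ) →
  sum (map f (wordsOfLength (suc n)))
    ≡ sum (map (f ∘ (false ∷_)) (wordsOfLength n)) + sum (map (f ∘ (true ∷_)) (wordsOfLength n))
sum-wordsOfLength-suc n f = go (wordsOfLength n)
  where
  go : ∀ ws → sum (map f (concatMap (λ w → (false ∷ w) ∷ (true ∷ w) ∷ []) ws))
              ≡ sum (map (f ∘ (false ∷_)) ws) + sum (map (f ∘ (true ∷_)) ws)
  go [] = refl
  go (w ∷ ws) = begin
    f (false ∷ w) + (f (true ∷ w) + sum (map f (concatMap _ ws)))
      ≡⟨ cong (λ s → f (false ∷ w) + (f (true ∷ w) + s)) (go ws) ⟩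
    f (false ∷ w) + (f (true ∷ w) + (sum (map (f ∘ (false ∷_)) ws) + sum (map (f ∘ (true ∷_)) ws)))
      ≡⟨ sym (+-assoc (f (false ∷ w)) _ _) ⟩
    f (false ∷ w) + f (true ∷ w) + (sum (map (f ∘ (false ∷_)) ws) + sum (map (f ∘ (true ∷_)) ws))
      ≡⟨ interchange (f (false ∷ w)) _ _ _ ⟩
    (f (false ∷ w) + sum (map (f ∘ (false ∷_)) ws)) + (f (true ∷ w) + sum (map (f ∘ (true ∷_)) ws)) ∎

sum-wordsOfLength-complement : ∀ n (f : Word → ℕ) →
  sum (map (f ∘ complement) (wordsOfLength n)) ≡ sum (map f (wordsOfLength n))
sum-wordsOfLength-complement zero    f = refl
sum-wordsOfLength-complement (suc n) f = begin
  sum (map (f ∘ complement) (wordsOfLength (suc n)))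
    ≡⟨ sum-wordsOfLength-suc n (f ∘ complement) ⟩
  sum (map (f ∘ (true ∷_) ∘ complement) W) + sum (map (f ∘ (false ∷_) ∘ complement) W)
    ≡⟨ cong₂ _+_ (sum-wordsOfLength-complement n (f ∘ (true ∷_)))
                 (sum-wordsOfLength-complement n (f ∘ (false ∷_))) ⟩
  sum (map (f ∘ (true ∷_)) W) + sum (map (f ∘ (false ∷_)) W)
    ≡⟨ +-comm (sum (map (f ∘ (true ∷_)) W)) _ ⟩
  sum (map (f ∘ (false ∷_)) W) + sum (map (f ∘ (true ∷_)) W)
    ≡⟨ sum-wordsOfLength-suc n f ⟨
  sum (map f (wordsOfLength (suc n))) ∎
  where W = wordsOfLength n

complementTail : Word → Word
complementTail []      = []
complementTail (b ∷ v) = b ∷ complement v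

sum-wordsOfLength-complementTail : ∀ n (f : Word → ℕ) →
  sum (map (f ∘ complementTail) (wordsOfLength n)) ≡ sum (map f (wordsOfLength n))
sum-wordsOfLength-complementTail zero    f = refl
sum-wordsOfLength-complementTail (suc n) f = begin
  sum (map (f ∘ complementTail) (wordsOfLength (suc n)))
    ≡⟨ sum-wordsOfLength-suc n (f ∘ complementTail) ⟩
  sum (map (f ∘ (false ∷_) ∘ complement) W) + sum (map (f ∘ (true ∷_) ∘ complement) W)
    ≡⟨ cong₂ _+_ (sum-wordsOfLength-complement n (f ∘ (false ∷_)))
                 (sum-wordsOfLength-complement n (f ∘ (true ∷_))) ⟩
  sum (map (f ∘ (false ∷_)) W) + sum (map (f ∘ (true ∷_)) W)
    ≡⟨ sum-wordsOfLength-suc n f ⟨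
  sum (map f (wordsOfLength (suc n))) ∎
  where W = wordsOfLength n

sum-wordsUpTo-complementTail : ∀ n (f : Word → ℕ) →
  sum (map (f ∘ complementTail) (wordsUpTo n)) ≡ sum (map f (wordsUpTo n))
sum-wordsUpTo-complementTail zero    f = refl
sum-wordsUpTo-complementTail (suc n) f = begin
  sum (map (f ∘ complementTail) (wordsUpTo n ++ wordsOfLength (suc n)))
    ≡⟨ cong sum (map-++ (f ∘ complementTail) (wordsUpTo n) _) ⟩
  sum (map (f ∘ complementTail) (wordsUpTo n) ++ map (f ∘ complementTail) (wordsOfLength (suc n)))
    ≡⟨ sum-++ (map (f ∘ complementTail) (wordsUpTo n)) _ ⟩
  sum (map (f ∘ complementTail) (wordsUpTo n)) + sum (map (f ∘ complementTail) (wordsOfLength (suc n)))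
    ≡⟨ cong₂ _+_ (sum-wordsUpTo-complementTail n f) (sum-wordsOfLength-complementTail (suc n) f) ⟩
  sum (map f (wordsUpTo n)) + sum (map f (wordsOfLength (suc n)))
    ≡⟨ sum-++ (map f (wordsUpTo n)) _ ⟨
  sum (map f (wordsUpTo n) ++ map f (wordsOfLength (suc n)))
    ≡⟨ cong sum (map-++ f (wordsUpTo n) _) ⟨
  sum (map f (wordsUpTo n ++ wordsOfLength (suc n))) ∎

binom-complement : ∀ u v → binom (complement u) (complement v) ≡ binom u v
binom-complement []          []          = refl
binom-complement []          (b ∷ v)     = refl
binom-complement (a ∷ u)     []          = refl
binom-complement (true ∷ u)  (true ∷ v)  = cong₂ _+_ (binom-complement u (true ∷ v)) (binom-complement u v)
binom-complement (true ∷ u)  (false ∷ v) = binom-complement u (false ∷ v)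
binom-complement (false ∷ u) (true ∷ v)  = binom-complement u (true ∷ v)
binom-complement (false ∷ u) (false ∷ v) = cong₂ _+_ (binom-complement u (false ∷ v)) (binom-complement u v)

binom-∷-∷ : ∀ a u v → binom (a ∷ u) (a ∷ v) ≡ binom u (a ∷ v) + binom u v
binom-∷-∷ a u v with a ≟ᵇ a
... | yes _   = refl
... | no a≢a = contradiction refl a≢a

binom-monoˡ-∷ : ∀ a u v → binom u v ≤ binom (a ∷ u) v
binom-monoˡ-∷ a u []      = ≤-refl
binom-monoˡ-∷ a u (b ∷ v) with a ≟ᵇ b
... | yes _ = m≤m+n (binom u (b ∷ v)) (binom u v)
... | no _  = ≤-refl

binom-∷ˡ-≡0 : ∀ a u v → binom (a ∷ u) v ≡ 0 → binom u v ≡ 0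
binom-∷ˡ-≡0 a u v auv≡0 = n≤0⇒n≡0 (subst (binom u v ≤_) auv≡0 (binom-monoˡ-∷ a u v))

binom-∷ʳ-≡0 : ∀ u b v → binom u v ≡ 0 → binom u (b ∷ v) ≡ 0
binom-∷ʳ-≡0 []      b v _    = refl
binom-∷ʳ-≡0 (a ∷ u) b v auv≡0 with a ≟ᵇ b | binom-∷ˡ-≡0 a u v auv≡0
... | yes _ | uv≡0 = cong₂ _+_ (binom-∷ʳ-≡0 u b v uv≡0) uv≡0
... | no _  | uv≡0 = binom-∷ʳ-≡0 u b v uv≡0

binom-∷-∷-positive : ∀ a u v → 0 < binom (a ∷ u) (a ∷ v) ⇔ 0 < binom u v
binom-∷-∷-positive a u v rewrite binom-∷-∷ a u v = mk⇔ to from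
  where
  to : 0 < binom u (a ∷ v) + binom u v → 0 < binom u v
  to pos = n≢0⇒n>0 λ uv≡0 → n>0⇒n≢0 pos (cong₂ _+_ (binom-∷ʳ-≡0 u a v uv≡0) uv≡0)
  from : 0 < binom u v → 0 < binom u (a ∷ v) + binom u v
  from pos = ≤-trans pos (m≤n+m (binom u v) (binom u (a ∷ v)))

L2Subword : Word → Word → Set
L2Subword u v = InL2 v × 0 < binom u v

L2Subword-complementTail : ∀ u v → L2Subword (true ∷ u) v ⇔ L2Subword (true ∷ complement u) (complementTail v)
L2Subword-complementTail u []          = mk⇔ id id
L2Subword-complementTail u (false ∷ v) = mk⇔ (λ ()) (λ ())
L2Subword-complementTail u (true ∷ v)  = mk⇔ (λ (_ , p) → refl , Equivalence.to positive p)
                                             (λ (_ , p) → refl , Equivalence.from positive p)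
  where
  positive : 0 < binom (true ∷ u) (true ∷ v) ⇔ 0 < binom (true ∷ complement u) (true ∷ complement v)
  positive = ⇔-sym (binom-∷-∷-positive true (complement u) (complement v))
         ⇔-∘ subst (λ n → 0 < binom (true ∷ u) (true ∷ v) ⇔ 0 < n)
                   (sym (binom-complement u v)) (binom-∷-∷-positive true u v)

countL2Subwords-complement : ∀ u → countL2Subwords (true ∷ u) ≡ countL2Subwords (true ∷ complement u)
countL2Subwords-complement u = begin
  length (filter P? W)                                  ≡⟨ length-filter-sum P? W ⟩
  sum (map (indicator ∘ P?) W)                          ≡⟨ cong sum (map-cong same-indicator W) ⟩
  sum (map (indicator ∘ Q? ∘ complementTail) W)         ≡⟨ sum-wordsUpTo-complementTail (suc (length u)) (indicator ∘ Q?) ⟩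
  sum (map (indicator ∘ Q?) W)                          ≡⟨ length-filter-sum Q? W ⟨
  length (filter Q? W)                                  ≡⟨ cong (λ n → length (filter Q? (wordsUpTo (suc n)))) (length-map not u) ⟨
  countL2Subwords (true ∷ complement u)                 ∎
  where
  W = wordsUpTo (suc (length u))
  P? : (v : Word) → Dec (L2Subword (true ∷ u) v)
  P? v = inL2? v ×-dec (0 <? binom (true ∷ u) v)
  Q? : (v : Word) → Dec (L2Subword (true ∷ complement u) v)
  Q? v = inL2? v ×-dec (0 <? binom (true ∷ complement u) v)
  same-indicator : ∀ v → indicator (P? v) ≡ indicator (Q? (complementTail v))
  same-indicator v = cong (if_then 1 else 0) (does-⇔ (L2Subword-complementTail u v) (P? v) (Q? (complementTail v)))

bitValue : Bool → ℕ
bitValue false = 0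
bitValue true  = 1

bitValue<2 : ∀ b → bitValue b < 2
bitValue<2 false = s≤s z≤n
bitValue<2 true  = s≤s (s≤s z≤n)

bitValue-not : ∀ b → bitValue b + bitValue (not b) ≡ 1
bitValue-not false = refl
bitValue-not true  = refl

lsbValue : Word → ℕ
lsbValue []      = 0
lsbValue (b ∷ w) = bitValue b + 2 * lsbValue w

[bit+2X]%2≡bit : ∀ b X → (bitValue b + 2 * X) % 2 ≡ bitValue b
[bit+2X]%2≡bit b X = begin
  (bitValue b + 2 * X) % 2 ≡⟨ cong (λ n → (bitValue b + n) % 2) (*-comm 2 X) ⟩
  (bitValue b + X * 2) % 2 ≡⟨ [m+kn]%n≡m%n (bitValue b) X 2 ⟩
  bitValue b % 2           ≡⟨ m<n⇒m%n≡m (bitValue<2 b) ⟩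
  bitValue b               ∎

[bit+2X]/2≡X : ∀ b X → (bitValue b + 2 * X) / 2 ≡ X
[bit+2X]/2≡X b X = begin
  (bitValue b + 2 * X) / 2     ≡⟨ cong (λ n → (bitValue b + n) / 2) (*-comm 2 X) ⟩
  (bitValue b + X * 2) / 2     ≡⟨ +-distrib-/ (bitValue b) (X * 2) no-carry ⟩
  bitValue b / 2 + X * 2 / 2   ≡⟨ cong₂ _+_ (m<n⇒m/n≡0 (bitValue<2 b)) (m*n/n≡m X 2) ⟩
  X                            ∎
  where
  no-carry : bitValue b % 2 + X * 2 % 2 < 2
  no-carry = subst (_< 2) (sym (trans (cong₂ _+_ (m<n⇒m%n≡m (bitValue<2 b)) (m*n%n≡0 X 2))
                                      (+-identityʳ (bitValue b))))
                   (bitValue<2 b)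

lsbDigits-step : ∀ f b X → 0 < X → lsbDigits (suc f) (bitValue b + 2 * X) ≡ b ∷ lsbDigits f X
lsbDigits-step f false (suc x) _ = cong₂ _∷_ (cong (_≡ᵇ 1) ([bit+2X]%2≡bit false (suc x)))
                                             (cong (lsbDigits f) ([bit+2X]/2≡X false (suc x)))
lsbDigits-step f true  X       _ = cong₂ _∷_ (cong (_≡ᵇ 1) ([bit+2X]%2≡bit true X))
                                             (cong (lsbDigits f) ([bit+2X]/2≡X true X))

lsbDigits-lsbValue : ∀ w f → 2 ^ length w + lsbValue w ≤ f →
                     lsbDigits f (2 ^ length w + lsbValue w) ≡ w ++ [ true ]
lsbDigits-lsbValue []      (suc zero)    _   = refl
lsbDigits-lsbValue []      (suc (suc f)) _   = refl
lsbDigits-lsbValue (b ∷ w) zero          N≤0 =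
  contradiction (≤-trans (m^n>0 2 (suc (length w))) (≤-trans (m≤m+n _ _) N≤0)) λ ()
lsbDigits-lsbValue (b ∷ w) (suc f)       N≤f = begin
  lsbDigits (suc f) (2 ^ suc (length w) + lsbValue (b ∷ w)) ≡⟨ cong (lsbDigits (suc f)) N≡b+2X ⟩
  lsbDigits (suc f) (bitValue b + 2 * X)                     ≡⟨ lsbDigits-step f b X X>0 ⟩
  b ∷ lsbDigits f X                                          ≡⟨ cong (b ∷_) (lsbDigits-lsbValue w f X≤f) ⟩
  b ∷ w ++ [ true ]                                          ∎
  where
  X = 2 ^ length w + lsbValue w
  X>0 : 0 < X
  X>0 = ≤-trans (m^n>0 2 (length w)) (m≤m+n _ _)
  N≡b+2X : 2 ^ suc (length w) + lsbValue (b ∷ w) ≡ bitValue b + 2 * X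
  N≡b+2X = regroup (2 ^ length w) (bitValue b) (lsbValue w)
    where
    regroup : ∀ p b v → 2 * p + (b + 2 * v) ≡ b + 2 * (p + v)
    regroup = solve-∀
  X<b+2X : X < bitValue b + 2 * X
  X<b+2X = ≤-trans (m<m+n X (≤-trans X>0 (m≤m+n X 0))) (m≤n+m (2 * X) (bitValue b))
  X≤f : X ≤ f
  X≤f = s≤s⁻¹ (<-≤-trans X<b+2X (subst (_≤ suc f) N≡b+2X N≤f))

rep2-lsbValue : ∀ w → rep2 (2 ^ length w + lsbValue w) ≡ true ∷ reverse w
rep2-lsbValue w = trans (cong reverse (lsbDigits-lsbValue w _ ≤-refl)) (reverse-++ w [ true ])

lsbValue-complement : ∀ w → lsbValue w + lsbValue (complement w) + 1 ≡ 2 ^ length w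
lsbValue-complement []      = refl
lsbValue-complement (b ∷ w) = begin
  bitValue b + 2 * v + (bitValue (not b) + 2 * c) + 1 ≡⟨ regroup (bitValue b) (bitValue (not b)) v c ⟩
  bitValue b + bitValue (not b) + 2 * (v + c) + 1     ≡⟨ cong (λ n → n + 2 * (v + c) + 1) (bitValue-not b) ⟩
  1 + 2 * (v + c) + 1                                 ≡⟨ double (v + c) ⟩
  2 * (v + c + 1)                                     ≡⟨ cong (2 *_) (lsbValue-complement w) ⟩
  2 * 2 ^ length w                                    ∎
  where
  v = lsbValue w
  c = lsbValue (complement w)
  regroup : ∀ x y v c → x + 2 * v + (y + 2 * c) + 1 ≡ x + y + 2 * (v + c) + 1
  regroup = solve-∀
  double : ∀ n → 1 + 2 * n + 1 ≡ 2 * (n + 1)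
  double = solve-∀

halve : ∀ r → ∃ λ b → ∃ λ q → bitValue b + 2 * q ≡ r
halve zero    = false , 0 , refl
halve (suc r) with halve r
... | false , q , refl = true , q , refl
... | true  , q , refl = false , suc q , cong suc (+-suc q (q + 0))

lsbValue-surjective : ∀ k r → r < 2 ^ k → ∃ λ w → length w ≡ k × lsbValue w ≡ r
lsbValue-surjective zero    zero    _          = [] , refl , refl
lsbValue-surjective zero    (suc r) (s≤s ())
lsbValue-surjective (suc k) r       r<2^[1+k] with halve r
... | b , q , refl with lsbValue-surjective k q q<2^k
  where
  q<2^k : q < 2 ^ k
  q<2^k = *-cancelˡ-< 2 q (2 ^ k) (≤-<-trans (m≤n+m (2 * q) (bitValue b)) r<2^[1+k])
...   | w , refl , refl = b ∷ w , refl , refl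

double-minus : ∀ {P v c} → v + c + 1 ≡ P → 2 * P ∸ v ∸ 1 ≡ P + c
double-minus {v = v} {c} refl = begin
  2 * (v + c + 1) ∸ v ∸ 1                 ≡⟨ cong (λ n → n ∸ v ∸ 1) (regroup v c) ⟩
  v + suc (v + c + 1 + c) ∸ v ∸ 1         ≡⟨ cong (_∸ 1) (m+n∸m≡n v _) ⟩
  v + c + 1 + c                           ∎
  where
  regroup : ∀ v c → 2 * (v + c + 1) ≡ v + suc (v + c + 1 + c)
  regroup = solve-∀

S-complement : ∀ ℓ r → r < 2 ^ ℓ → S (2 ^ ℓ + r) ≡ S (2 ^ (ℓ + 1) ∸ r ∸ 1)
S-complement ℓ r r<2^ℓ with lsbValue-surjective ℓ r r<2^ℓ
... | w , refl , refl = begin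
  countL2Subwords (rep2 (2 ^ length w + lsbValue w))           ≡⟨ cong countL2Subwords (rep2-lsbValue w) ⟩
  countL2Subwords (true ∷ reverse w)                           ≡⟨ countL2Subwords-complement (reverse w) ⟩
  countL2Subwords (true ∷ complement (reverse w))              ≡⟨ cong (countL2Subwords ∘ (true ∷_)) (reverse-map not w) ⟩
  countL2Subwords (true ∷ reverse (complement w))              ≡⟨ cong countL2Subwords (rep2-lsbValue (complement w)) ⟨
  S (2 ^ length (complement w) + lsbValue (complement w))      ≡⟨ cong (λ n → S (2 ^ n + lsbValue (complement w))) (length-map not w) ⟩
  S (2 ^ length w + lsbValue (complement w))                   ≡⟨ cong S (double-minus (lsbValue-complement w)) ⟨
  S (2 * 2 ^ length w ∸ lsbValue w ∸ 1)                        ≡⟨ cong (λ n → S (2 ^ n ∸ lsbValue w ∸ 1)) (+-comm 1 (length w)) ⟩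
  S (2 ^ (length w + 1) ∸ lsbValue w ∸ 1)                      ∎

lemma3p2 : ((u : Word) → countL2Subwords (true ∷ u) ≡ countL2Subwords (true ∷ complement u))
           × ((ℓ r : ℕ) → 1 ≤ ℓ → 2 ^ (ℓ ∸ 1) ≤ r → r < 2 ^ ℓ → S (2 ^ ℓ + r) ≡ S (2 ^ (ℓ + 1) ∸ r ∸ 1))
lemma3p2 = countL2Subwords-complement , λ ℓ r _ _ → S-complement ℓ r
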